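{- For any finite simple graph $G$ with at least one edge, $D_{\Gamma(G)}(G)$ is not connected.
   Context: A set $S \subseteq V(G)$ is a dominating set of $G$ if every vertex of $V(G)\setminus S$ is adjacent to a vertex of $S$; it is a minimal dominating set if no proper subset is a dominating set. $\Gamma(G)$ (the upper domination number) is the maximum cardinality of a minimal dominating set of $G$. For an integer $k$ at least the minimum cardinality of a dominating set of $G$, the $k$-dominating graph $D_k(G)$ is the graph whose vertices are the dominating sets of $G$ of cardinality at most $k$, two such sets $A,B$ being adjacent if and only if their symmetric difference $(A\setminus B)\cup(B\setminus A)$ consists of exactly one vertex of $G$. -}

module Defs where

open import Data.Nat using (ℕ; _≤_)
open import Data.Bool using (Bool; T)
open import Data.Fin using (Fin)
open import Data.Fin.Subset using (Subset; _∈_; _∉_; _⊂_; _∪_; _─_; ∣_∣)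
open import Data.Product using (Σ; ∃; ∃-syntax; _×_; _,_; proj₁)
open import Relation.Nullary using (¬_)
open import Relation.Binary.PropositionalEquality using (_≡_)
open import Relation.Binary.Construct.Closure.ReflexiveTransitive using (Star)

record Graph (n : ℕ) : Set where
  field
    adj     : Fin n → Fin n → Bool
    sym     : ∀ u v → adj u v ≡ adj v u
    irrefl  : ∀ v → adj v v ≡ Data.Bool.false

open Graph public

Adj : ∀ {n} → Graph n → Fin n → Fin n → Set
Adj G u v = T (adj G u v)

HasEdge : ∀ {n} → Graph n → Set
HasEdge G = ∃[ u ] ∃[ v ] Adj G u v

Dominating : ∀ {n} → Graph n → Subset n → Set
Dominating G S = ∀ v → v ∉ S → ∃[ u ] (u ∈ S × Adj G u v)

MinimalDominating : ∀ {n} → Graph n → Subset n → Set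
MinimalDominating G S = Dominating G S × (∀ T → T ⊂ S → ¬ Dominating G T)

IsUpperDomination : ∀ {n} → Graph n → ℕ → Set
IsUpperDomination G k =
  (∃[ S ] (MinimalDominating G S × ∣ S ∣ ≡ k))
  × (∀ S → MinimalDominating G S → ∣ S ∣ ≤ k)

DkVertex : ∀ {n} → Graph n → ℕ → Set
DkVertex {n} G k = Σ (Subset n) (λ S → Dominating G S × ∣ S ∣ ≤ k)

symDiff : ∀ {n} → Subset n → Subset n → Subset n
symDiff A B = (A ─ B) ∪ (B ─ A)

DkAdj : ∀ {n} (G : Graph n) (k : ℕ) → DkVertex G k → DkVertex G k → Set
DkAdj G k A B = ∣ symDiff (proj₁ A) (proj₁ B) ∣ ≡ 1

DkConnected : ∀ {n} → Graph n → ℕ → Set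
DkConnected G k = ∀ (A B : DkVertex G k) → Star (DkAdj G k) A B

-- Γ(G) is attained by a minimal dominating set S.  In D_Γ(G) the vertex S is
-- isolated: a neighbour of S differs from it in exactly one vertex, so it is
-- either a proper subset of S (not dominating, by minimality) or has Γ(G) + 1
-- elements (too large).  On the other hand, if G has an edge then some x ∈ S
-- has a neighbour, so V(G) ∖ {x} is dominating; shrinking it to a minimal
-- dominating set gives a second vertex of D_Γ(G) that avoids x and hence is
-- different from S.  A graph with an isolated vertex and another vertex is not
-- connected.
module Submission where

open import Defs
open import Data.Nat using (ℕ; suc; _≤_; pred)
open import Data.Nat.Properties using (≤-reflexive; <-irrefl)
open import Data.Bool using (true; false; T; T?)
open import Data.Fin using (_≟_)
open import Data.Fin.Subset using (Subset; _∈_; _∉_; _⊆_; _⊂_; ∣_∣; ∁; ⁅_⁆)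
open import Data.Fin.Subset.Properties
  using (_∈?_; _⊂?_; anySubset?; ⊆-refl; ⊆-trans; s⊂s; out⊂in; x∈⁅x⁆; x∈⁅y⁆⇒x≡y; x∈∁p⇒x∉p; x∉p⇒x∈∁p)
open import Data.Fin.Subset.Induction using (⊂-wellFounded)
open import Data.Fin.Properties using (all?; any?)
open import Data.Vec using (_∷_; [])
open import Data.Product using (∃-syntax; _×_; _,_; proj₁; proj₂)
open import Data.Sum using (_⊎_; inj₁; inj₂)
open import Level using (Level)
open import Relation.Nullary using (¬_; yes; no; ¬?; contradiction)
open import Relation.Nullary.Decidable using (_×-dec_; _→-dec_)
open import Relation.Unary using (Pred; Decidable)
open import Relation.Binary.PropositionalEquality using (_≡_; _≢_; refl; cong; trans; subst)
open import Relation.Binary.Construct.Closure.ReflexiveTransitive using (Star; ε; _◅_)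
open import Induction.WellFounded using (Acc; acc)

private
  variable
    a ℓ : Level
    n : ℕ

symDiff-empty⇒≡ : (S C : Subset n) → ∣ symDiff S C ∣ ≡ 0 → S ≡ C
symDiff-empty⇒≡ []          []          _  = refl
symDiff-empty⇒≡ (true ∷ S)  (true ∷ C)  e  = cong (true ∷_)  (symDiff-empty⇒≡ S C e)
symDiff-empty⇒≡ (false ∷ S) (false ∷ C) e  = cong (false ∷_) (symDiff-empty⇒≡ S C e)
symDiff-empty⇒≡ (true ∷ S)  (false ∷ C) ()
symDiff-empty⇒≡ (false ∷ S) (true ∷ C)  ()

symDiff-single⇒shrink⊎grow : (S C : Subset n) → ∣ symDiff S C ∣ ≡ 1 → C ⊂ S ⊎ ∣ C ∣ ≡ suc ∣ S ∣
symDiff-single⇒shrink⊎grow [] [] ()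
symDiff-single⇒shrink⊎grow (true ∷ S) (true ∷ C) e with symDiff-single⇒shrink⊎grow S C e
... | inj₁ C⊂S = inj₁ (s⊂s C⊂S)
... | inj₂ grow = inj₂ (cong suc grow)
symDiff-single⇒shrink⊎grow (false ∷ S) (false ∷ C) e with symDiff-single⇒shrink⊎grow S C e
... | inj₁ C⊂S = inj₁ (s⊂s C⊂S)
... | inj₂ grow = inj₂ grow
symDiff-single⇒shrink⊎grow (true ∷ S) (false ∷ C) e with symDiff-empty⇒≡ S C (cong pred e)
... | refl = inj₁ (out⊂in ⊆-refl)
symDiff-single⇒shrink⊎grow (false ∷ S) (true ∷ C) e with symDiff-empty⇒≡ S C (cong pred e)
... | refl = inj₂ refl

Minimal : Pred (Subset n) ℓ → Subset n → Set ℓ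
Minimal P S = P S × (∀ U → U ⊂ S → ¬ P U)

minimal-below : {P : Pred (Subset n) ℓ} → Decidable P →
                ∀ {T} → P T → ∃[ S ] (S ⊆ T × Minimal P S)
minimal-below {P = P} P? {T} = descend T (⊂-wellFounded T)
  where
  descend : ∀ T → Acc _⊂_ T → P T → ∃[ S ] (S ⊆ T × Minimal P S)
  descend T (acc below) PT with anySubset? (λ U → (U ⊂? T) ×-dec P? U)
  ... | no none = T , ⊆-refl , PT , λ U U⊂T PU → none (U , U⊂T , PU)
  ... | yes (U , U⊂T , PU) with descend U (below U⊂T) PU
  ...   | S , S⊆U , minS = S , ⊆-trans S⊆U (proj₁ U⊂T) , minS

walk-from-isolated : {A : Set a} {R : A → A → Set ℓ} {x y : A} →
                     (∀ z → ¬ R x z) → Star R x y → x ≡ y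
walk-from-isolated isolated ε           = refl
walk-from-isolated isolated (step ◅ _) = contradiction step (isolated _)

module _ (G : Graph n) where

  dominating? : Decidable (Dominating G)
  dominating? S = all? λ v → ¬? (v ∈? S) →-dec any? λ u → (u ∈? S) ×-dec T? (adj G u v)

  adjacent⇒distinct : ∀ {u v} → Adj G u v → u ≢ v
  adjacent⇒distinct {u} u~u refl = subst T (irrefl G u) u~u

  -- If G has an edge, every dominating set contains a vertex with a neighbour:
  -- either an endpoint of the edge lies in S, or S dominates it.
  dominating-meets-edge : HasEdge G → ∀ {S} → Dominating G S → ∃[ x ] ∃[ z ] (x ∈ S × Adj G z x)
  dominating-meets-edge (u , v , u~v) {S} domS with u ∈? S
  ... | yes u∈S = u , v , u∈S , subst T (Graph.sym G u v) u~v
  ... | no  u∉S with domS u u∉S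
  ...   | w , w∈S , w~u = w , u , w∈S , subst T (Graph.sym G w u) w~u

  -- Deleting a vertex x with a neighbour z leaves a dominating set: only x
  -- itself needs a dominator, and z ≠ x is still present.
  delete-vertex-dominating : ∀ {x z} → Adj G z x → Dominating G (∁ ⁅ x ⁆)
  delete-vertex-dominating {x} {z} z~x v v∉ with v ≟ x
  ... | no v≢x   = contradiction (x∉p⇒x∈∁p λ v∈⁅x⁆ → v≢x (x∈⁅y⁆⇒x≡y x v∈⁅x⁆)) v∉
  ... | yes refl = z , x∉p⇒x∈∁p (λ z∈⁅x⁆ → adjacent⇒distinct z~x (x∈⁅y⁆⇒x≡y x z∈⁅x⁆)) , z~x

  maximum-minimal-isolated : ∀ {k S} (minS : MinimalDominating G S) (∣S∣≡k : ∣ S ∣ ≡ k) →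
                             ∀ C → ¬ DkAdj G k (S , proj₁ minS , ≤-reflexive ∣S∣≡k) C
  maximum-minimal-isolated {k} {S} (_ , noSmaller) ∣S∣≡k (C , domC , ∣C∣≤k) S~C
    with symDiff-single⇒shrink⊎grow S C S~C
  ... | inj₁ C⊂S = noSmaller C C⊂S domC
  ... | inj₂ grow = <-irrefl refl (subst (_≤ k) (trans grow (cong suc ∣S∣≡k)) ∣C∣≤k)

lemma3 : ∀ {n} (G : Graph n) → HasEdge G → (k : ℕ) → IsUpperDomination G k → ¬ DkConnected G k
lemma3 G edge k ((S , minS , ∣S∣≡k) , maximal) connected
  with dominating-meets-edge G edge (proj₁ minS)
... | x , z , x∈S , z~x
  with minimal-below (dominating? G) (delete-vertex-dominating G z~x)
...   | S′ , S′⊆V∖x , minS′ = x∉S′ (subst (x ∈_) S≡S′ x∈S)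
  where
  A B : DkVertex G k
  A = S  , proj₁ minS , ≤-reflexive ∣S∣≡k
  B = S′ , proj₁ minS′ , maximal S′ minS′

  S≡S′ : S ≡ S′
  S≡S′ = cong proj₁ (walk-from-isolated (maximum-minimal-isolated G minS ∣S∣≡k) (connected A B))

  x∉S′ : x ∉ S′
  x∉S′ x∈S′ = x∈∁p⇒x∉p (S′⊆V∖x x∈S′) (x∈⁅x⁆ x)
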